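{- Let $k\ge 0$ be an integer and let $G$ be a $(k+1)$-edge-connected graph with $m$ edges. Then \[ f_2(M(G))\le m-\frac{3(k+1)}{2}. \]
   Context: For a graph $G=(V,E)$, the cycle matroid $M(G)$ is the matroid on $E$ with rank function $rk(A)=|V|-k(A)$, where $k(A)$ is the number of components of the spanning subgraph $(V,A)$. For a matroid $M=(X,rk)$ of rank $r=rk(X)$, a flat is a set $F\subseteq X$ with $\{e\in X: rk(F\cup\{e\})=rk(F)\}=F$, and $f_2(M)=\max\{|F|: F\text{ a flat of }M,\ rk(F)=r-2\}$. -}

module Defs where

open import Data.Nat using (ℕ; _+_; _<_)
open import Data.Fin using (Fin; toℕ)
open import Data.Fin.Subset using (Subset; _∈_; _∪_; ⁅_⁆; ⊤; _─_; ∣_∣)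
open import Data.Product using (Σ; _×_; _,_)
open import Data.Sum using (_⊎_)
open import Relation.Nullary using (¬_)
open import Relation.Binary.PropositionalEquality using (_≡_)
open import Function.Bundles using (_⇔_)

-- A finite (multi)graph: vertex set Fin n, edge set Fin m, each edge has
-- two (unordered) endpoints; loops and parallel edges are allowed.
record Graph : Set where
  field
    nV   : ℕ
    nE   : ℕ
    ends : Fin nE → Fin nV × Fin nV
open Graph public

Joins : (G : Graph) → Fin (nE G) → Fin (nV G) → Fin (nV G) → Set
Joins G e u w = (ends G e ≡ (u , w)) ⊎ (ends G e ≡ (w , u))

data Connected (G : Graph) (A : Subset (nE G)) (u : Fin (nV G)) : Fin (nV G) → Set where
  here : Connected G A u u
  step : ∀ {v w} → Connected G A u v → (e : Fin (nE G)) → e ∈ A → Joins G e v w → Connected G A u w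

IsRep : (G : Graph) → Subset (nE G) → Fin (nV G) → Set
IsRep G A v = ∀ u → toℕ u < toℕ v → ¬ Connected G A u v

NumComponents : (G : Graph) → Subset (nE G) → ℕ → Set
NumComponents G A c = Σ (Subset (nV G)) λ R → ((∀ v → (v ∈ R) ⇔ IsRep G A v) × ∣ R ∣ ≡ c)

-- Cycle matroid rank: rk(A) = r  iff  r = |V| - k(A).
Rank : (G : Graph) → Subset (nE G) → ℕ → Set
Rank G A r = Σ ℕ λ c → NumComponents G A c × (r + c ≡ nV G)

IsFlat : (G : Graph) → Subset (nE G) → Set
IsFlat G F = ∀ e → (e ∈ F) ⇔ (Σ ℕ λ r → Rank G F r × Rank G (F ∪ ⁅ e ⁆) r)

EdgeConnected : (G : Graph) → ℕ → Set
EdgeConnected G l = ∀ (S : Subset (nE G)) → ∣ S ∣ < l → ∀ u v → Connected G (⊤ ─ S) u v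

{-# OPTIONS --safe #-}
-- Let F have rank r − 2, so that (V, F) has k(F) = k(E) + 2 ≥ 3 components.
-- Each component C is a proper vertex set, so (k+1)-edge-connectivity puts at
-- least k+1 edges into the cut δ(C).  No edge of F lies in any such cut, and an
-- edge outside F lies in at most two of them, one for each end (the components
-- are disjoint).  Double counting gives 2|F| + k(F)(k+1) ≤ 2m, hence the bound.
module Submission where

open import Defs
open import Data.Nat.Properties
  using (+-*-semiring; ≤-refl; ≤-reflexive; ≤-trans; ≤-<-trans; <-cmp; ≮⇒≥; n≮0;
         +-mono-≤; +-monoʳ-≤; *-monoˡ-≤; +-assoc; *-comm; +-cancelˡ-≡;
         m≤m+n; m≤n+m; m<m+n; module ≤-Reasoning)
open import Algebra.Properties.Semiring.Sum +-*-semiring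
  using (sum-syntax; sum-cong-≗; sum-replicate-zero; ∑-distrib-+; ∑-comm; *-distribˡ-sum)
open import Data.Bool using (Bool; true; false; _xor_)
open import Data.Bool.Properties using (¬-not; xor-same)
open import Data.Fin using (Fin; zero; suc; toℕ; fromℕ<; punchIn; _≟_)
open import Data.Fin.Properties using (0≢1+n; suc-injective; toℕ-injective; toℕ-fromℕ<; punchInᵢ≢i)
open import Data.Fin.Subset using (Subset; ⊤; ∣_∣; _∈_; _∉_; _─_)
open import Data.Fin.Subset.Properties using (x∈p⇒∣p-x∣<∣p∣)
open import Data.Nat using (ℕ; zero; suc; _+_; _*_; _≤_; _<_; z≤n; s≤s; _≤?_)
open import Data.Product using (_,_; proj₁; proj₂)
open import Data.Sum using (inj₁; inj₂)
open import Data.Vec using ([]; _∷_; lookup; tabulate; here; there)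
open import Data.Vec.Properties using (lookup∘tabulate; lookup⇒[]=)
open import Function using (_∘_)
open import Function.Bundles using (Equivalence; mk⇔)
open import Function.Definitions using (Injective)
open import Relation.Binary.Definitions using (Decidable; tri<; tri≈; tri>)
open import Relation.Binary.PropositionalEquality
open import Relation.Nullary using (¬_; yes; no; does)
open import Relation.Nullary.Decidable using (decidable-stable; dec-true; does-⇔; ¬¬-excluded-middle)
open import Relation.Nullary.Negation using (contradiction; ¬¬-map)

xor≡false⇒≡ : ∀ a b → a xor b ≡ false → a ≡ b
xor≡false⇒≡ true  true  _ = refl
xor≡false⇒≡ false false _ = refl

𝟙 : Bool → ℕ
𝟙 true  = 1
𝟙 false = 0

𝟙-xor≤ : ∀ a b → 𝟙 (a xor b) ≤ 𝟙 a + 𝟙 b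
𝟙-xor≤ true  true  = z≤n
𝟙-xor≤ true  false = ≤-refl
𝟙-xor≤ false true  = ≤-refl
𝟙-xor≤ false false = z≤n

∑-mono-≤ : ∀ {n} {f g : Fin n → ℕ} → (∀ i → f i ≤ g i) → ∑[ i < n ] f i ≤ ∑[ i < n ] g i
∑-mono-≤ {zero}  _   = z≤n
∑-mono-≤ {suc n} f≤g = +-mono-≤ (f≤g zero) (∑-mono-≤ (f≤g ∘ suc))

∑-const : ∀ n c → ∑[ i < n ] c ≡ n * c
∑-const zero    c = refl
∑-const (suc n) c = cong (c +_) (∑-const n c)

∑-zero : ∀ {n} {f : Fin n → ℕ} → (∀ i → f i ≡ 0) → ∑[ i < n ] f i ≡ 0
∑-zero {n} f≗0 = trans (sum-cong-≗ f≗0) (sum-replicate-zero n)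

∑𝟙-atMostOne : ∀ {t} (b : Fin t → Bool) → (∀ i j → b i ≡ true → b j ≡ true → i ≡ j) →
  ∑[ i < t ] 𝟙 (b i) ≤ 1
∑𝟙-atMostOne {zero}  b unique = z≤n
∑𝟙-atMostOne {suc t} b unique with b zero in b₀
... | true  = s≤s (≤-reflexive (∑-zero λ i →
                cong 𝟙 (¬-not λ bᵢ → 0≢1+n (unique zero (suc i) b₀ bᵢ))))
... | false = ∑𝟙-atMostOne (b ∘ suc) λ i j bᵢ bⱼ → suc-injective (unique (suc i) (suc j) bᵢ bⱼ)

∣p∣≡∑𝟙 : ∀ {n} (p : Subset n) → ∣ p ∣ ≡ ∑[ i < n ] 𝟙 (lookup p i)
∣p∣≡∑𝟙 []          = refl
∣p∣≡∑𝟙 (true  ∷ p) = cong suc (∣p∣≡∑𝟙 p)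
∣p∣≡∑𝟙 (false ∷ p) = ∣p∣≡∑𝟙 p

Joins-sym : ∀ {G e v w} → Joins G e v w → Joins G e w v
Joins-sym (inj₁ ends≡vw) = inj₂ ends≡vw
Joins-sym (inj₂ ends≡wv) = inj₁ ends≡wv

module _ {G : Graph} {A : Subset (nE G)} where

  Connected-edge : ∀ {v w} e → e ∈ A → Joins G e v w → Connected G A v w
  Connected-edge = step here

  Connected-trans : ∀ {u v w} → Connected G A u v → Connected G A v w → Connected G A u w
  Connected-trans p here              = p
  Connected-trans p (step q e e∈A vw) = step (Connected-trans p q) e e∈A vw

  Connected-sym : ∀ {u v} → Connected G A u v → Connected G A v u
  Connected-sym here              = here
  Connected-sym (step p e e∈A vw) =
    Connected-trans (Connected-edge e e∈A (Joins-sym {G} vw)) (Connected-sym p)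

  IsRep-≢⇒¬Connected : ∀ {u v} → IsRep G A u → IsRep G A v → u ≢ v → ¬ Connected G A u v
  IsRep-≢⇒¬Connected {u} {v} rep-u rep-v u≢v u~v with <-cmp (toℕ u) (toℕ v)
  ... | tri< u<v _ _ = rep-v u u<v u~v
  ... | tri≈ _ u≡v _ = u≢v (toℕ-injective u≡v)
  ... | tri> _ _ v<u = rep-u v v<u (Connected-sym u~v)

x∈p─q⇒x∉q : ∀ {n} {x : Fin n} {p q : Subset n} → x ∈ p ─ q → x ∉ q
x∈p─q⇒x∉q {p = _ ∷ _} {false ∷ _} here        ()
x∈p─q⇒x∉q {p = _ ∷ _} {_     ∷ _} (there x∈) (there x∈q) = x∈p─q⇒x∉q x∈ x∈q

module _ (G : Graph) (C : Fin (nV G) → Bool) where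

  crosses : Fin (nE G) → Bool
  crosses e = C (proj₁ (ends G e)) xor C (proj₂ (ends G e))

  cut : Subset (nE G)
  cut = tabulate crosses

  ∣cut∣≡∑crosses : ∣ cut ∣ ≡ ∑[ e < nE G ] 𝟙 (crosses e)
  ∣cut∣≡∑crosses = trans (∣p∣≡∑𝟙 cut) (sum-cong-≗ (cong 𝟙 ∘ lookup∘tabulate crosses))

  ¬crosses⇒same-side : ∀ {e v w} → Joins G e v w → crosses e ≡ false → C v ≡ C w
  ¬crosses⇒same-side (inj₁ ends≡vw) ¬cross = subst (λ (x , y) → C x ≡ C y) ends≡vw (xor≡false⇒≡ _ _ ¬cross)
  ¬crosses⇒same-side (inj₂ ends≡wv) ¬cross = sym (¬crosses⇒same-side (inj₁ ends≡wv) ¬cross)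

  Connected-avoiding-cut⇒same-side : ∀ {u v} → Connected G (⊤ ─ cut) u v → C u ≡ C v
  Connected-avoiding-cut⇒same-side here = refl
  Connected-avoiding-cut⇒same-side (step p e e∉cut vw) =
    trans (Connected-avoiding-cut⇒same-side p) (¬crosses⇒same-side vw ¬cross)
    where
    ¬cross : crosses e ≡ false
    ¬cross = trans (sym (lookup∘tabulate crosses e)) (¬-not (x∈p─q⇒x∉q e∉cut ∘ lookup⇒[]= e cut))

  separating-cut-size : ∀ {l} → EdgeConnected G l → ∀ u v → C u ≢ C v → l ≤ ∣ cut ∣
  separating-cut-size conn u v Cu≢Cv =
    ≮⇒≥ λ small → Cu≢Cv (Connected-avoiding-cut⇒same-side (conn cut small u v))

cuts-handshake : (G : Graph) (F : Subset (nE G)) {t : ℕ} (C : Fin t → Fin (nV G) → Bool) →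
  (∀ v i j → C i v ≡ true → C j v ≡ true → i ≡ j) →
  (∀ j e → e ∈ F → crosses G (C j) e ≡ false) →
  2 * ∣ F ∣ + ∑[ j < t ] ∣ cut G (C j) ∣ ≤ 2 * nE G
cuts-handshake G F {t} C disjoint F-uncut = begin
  2 * ∣ F ∣ + ∑[ j < t ] ∣ cut G (C j) ∣
    ≡⟨ cong₂ _+_ (cong (2 *_) (∣p∣≡∑𝟙 F)) (sum-cong-≗ (∣cut∣≡∑crosses G ∘ C)) ⟩
  2 * ∑[ e < m ] 𝟙 (lookup F e) + ∑[ j < t ] ∑[ e < m ] 𝟙 (crosses G (C j) e)
    ≡⟨ cong₂ _+_ (*-distribˡ-sum 2 (𝟙 ∘ lookup F)) (∑-comm λ j e → 𝟙 (crosses G (C j) e)) ⟩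
  ∑[ e < m ] (2 * 𝟙 (lookup F e)) + ∑[ e < m ] ∑[ j < t ] 𝟙 (crosses G (C j) e)
    ≡⟨ ∑-distrib-+ (λ e → 2 * 𝟙 (lookup F e)) (λ e → ∑[ j < t ] 𝟙 (crosses G (C j) e)) ⟨
  ∑[ e < m ] (2 * 𝟙 (lookup F e) + ∑[ j < t ] 𝟙 (crosses G (C j) e))
    ≤⟨ ∑-mono-≤ edge-weight≤2 ⟩
  ∑[ e < m ] 2
    ≡⟨ ∑-const m 2 ⟩
  m * 2
    ≡⟨ *-comm m 2 ⟩
  2 * m ∎
  where
  open ≤-Reasoning
  m = nE G

  crossings≤2 : ∀ x y → ∑[ j < t ] 𝟙 (C j x xor C j y) ≤ 2
  crossings≤2 x y = begin
    ∑[ j < t ] 𝟙 (C j x xor C j y)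
      ≤⟨ ∑-mono-≤ (λ j → 𝟙-xor≤ (C j x) (C j y)) ⟩
    ∑[ j < t ] (𝟙 (C j x) + 𝟙 (C j y))
      ≡⟨ ∑-distrib-+ (𝟙 ∘ λ j → C j x) (𝟙 ∘ λ j → C j y) ⟩
    ∑[ j < t ] 𝟙 (C j x) + ∑[ j < t ] 𝟙 (C j y)
      ≤⟨ +-mono-≤ (∑𝟙-atMostOne _ (disjoint x)) (∑𝟙-atMostOne _ (disjoint y)) ⟩
    2 ∎

  edge-weight≤2 : ∀ e → 2 * 𝟙 (lookup F e) + ∑[ j < t ] 𝟙 (crosses G (C j) e) ≤ 2
  edge-weight≤2 e with lookup F e in e∈F
  ... | true  = +-monoʳ-≤ 2 (≤-reflexive (∑-zero λ j → cong 𝟙 (F-uncut j e (lookup⇒[]= e F e∈F))))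
  ... | false = crossings≤2 (proj₁ (ends G e)) (proj₂ (ends G e))

module _ {G : Graph} {A : Subset (nE G)} (_~?_ : Decidable (Connected G A)) where

  component : Fin (nV G) → Fin (nV G) → Bool
  component a v = does (a ~? v)

  component⇒Connected : ∀ {a v} → component a v ≡ true → Connected G A a v
  component⇒Connected {a} {v} with a ~? v
  ... | yes a~v = λ _ → a~v
  ... | no  _   = λ ()

  A-edge-uncut : ∀ a e → e ∈ A → crosses G (component a) e ≡ false
  A-edge-uncut a e e∈A =
    subst (λ b → component a x xor b ≡ false) same-side (xor-same (component a x))
    where
    x = proj₁ (ends G e)
    y = proj₂ (ends G e)
    x~y : Connected G A x y
    x~y = Connected-edge e e∈A (inj₁ refl)
    same-side : component a x ≡ component a y
    same-side = does-⇔ (mk⇔ (λ a~x → Connected-trans a~x x~y)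
                            (λ a~y → Connected-trans a~y (Connected-sym x~y)))
                       (a ~? x) (a ~? y)

  components-bound : ∀ {l} → EdgeConnected G l → ∀ {t} → 2 ≤ t → (a : Fin t → Fin (nV G)) →
    (∀ i j → Connected G A (a i) (a j) → i ≡ j) →
    2 * ∣ A ∣ + t * l ≤ 2 * nE G
  components-bound {l} conn {t@(suc (suc _))} (s≤s (s≤s _)) a separated = begin
    2 * ∣ A ∣ + t * l
      ≡⟨ cong (2 * ∣ A ∣ +_) (∑-const t l) ⟨
    2 * ∣ A ∣ + ∑[ j < t ] l
      ≤⟨ +-monoʳ-≤ (2 * ∣ A ∣) (∑-mono-≤ cut-large) ⟩
    2 * ∣ A ∣ + ∑[ j < t ] ∣ cut G (component (a j)) ∣
      ≤⟨ cuts-handshake G A (component ∘ a) disjoint (A-edge-uncut ∘ a) ⟩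
    2 * nE G ∎
    where
    open ≤-Reasoning
    disjoint : ∀ v i j → component (a i) v ≡ true → component (a j) v ≡ true → i ≡ j
    disjoint v i j aᵢ~v aⱼ~v = separated i j
      (Connected-trans (component⇒Connected aᵢ~v) (Connected-sym (component⇒Connected aⱼ~v)))
    cut-large : ∀ j → l ≤ ∣ cut G (component (a j)) ∣
    cut-large j = separating-cut-size G (component (a j)) conn (a j) (a i) λ same →
      punchInᵢ≢i j zero (sym (separated j i (component⇒Connected (trans (sym same) aⱼ∈component))))
      where
      i = punchIn j zero
      aⱼ∈component = dec-true (a j ~? a j) here

member : ∀ {n} (p : Subset n) → Fin ∣ p ∣ → Fin n
member (true  ∷ p) zero    = zero
member (true  ∷ p) (suc i) = suc (member p i)
member (false ∷ p) i       = suc (member p i)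

member-∈ : ∀ {n} (p : Subset n) i → member p i ∈ p
member-∈ (true  ∷ p) zero    = here
member-∈ (true  ∷ p) (suc i) = there (member-∈ p i)
member-∈ (false ∷ p) i       = there (member-∈ p i)

member-injective : ∀ {n} (p : Subset n) → Injective _≡_ _≡_ (member p)
member-injective (true  ∷ p) {zero}  {zero}  _  = refl
member-injective (true  ∷ p) {suc i} {suc j} eq = cong suc (member-injective p (suc-injective eq))
member-injective (false ∷ p)                 eq = member-injective p (suc-injective eq)

module _ {G : Graph} {A : Subset (nE G)} where

  representatives-separated : ∀ {R} → (∀ v → v ∈ R → IsRep G A v) →
    ∀ i j → Connected G A (member R i) (member R j) → i ≡ j
  representatives-separated {R} rep i j u~v with member R i ≟ member R j
  ... | yes u≡v = member-injective R u≡v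
  ... | no  u≢v =
    contradiction u~v (IsRep-≢⇒¬Connected (rep _ (member-∈ R i)) (rep _ (member-∈ R j)) u≢v)

  NumComponents-positive : ∀ {c} → NumComponents G A c → 0 < nV G → 0 < c
  NumComponents-positive (R , isRep⇔ , ∣R∣≡c) 0<n =
    subst (0 <_) ∣R∣≡c (≤-<-trans z≤n (x∈p⇒∣p-x∣<∣p∣ (Equivalence.from (isRep⇔ v₀) v₀-isRep)))
    where
    v₀ = fromℕ< 0<n
    v₀-isRep : IsRep G A v₀
    v₀-isRep u u<v₀ = contradiction (subst (toℕ u <_) (toℕ-fromℕ< 0<n) u<v₀) n≮0

rank-drop<components : ∀ {G : Graph} {A B r s d} →
  Rank G A r → (rk : Rank G B s) → s + suc d ≡ r → suc d < proj₁ rk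
rank-drop<components {G} {s = s} {d} (cA , components-A , r+cA≡n) (cB , _ , s+cB≡n) s+1+d≡r =
  subst (suc d <_) (sym cB≡1+d+cA) (m<m+n (suc d) (NumComponents-positive components-A 0<n))
  where
  s+1+d+cA≡n : s + suc d + cA ≡ nV G
  s+1+d+cA≡n = trans (cong (_+ cA) s+1+d≡r) r+cA≡n
  cB≡1+d+cA : cB ≡ suc d + cA
  cB≡1+d+cA = +-cancelˡ-≡ s cB (suc d + cA)
    (trans s+cB≡n (trans (sym s+1+d+cA≡n) (+-assoc s (suc d) cA)))
  0<n : 0 < nV G
  0<n = subst (0 <_) s+1+d+cA≡n
    (≤-trans (s≤s z≤n) (≤-trans (m≤n+m (suc d) s) (m≤m+n (s + suc d) cA)))

¬¬-∀-Fin : ∀ {n p} {P : Fin n → Set p} → (∀ i → ¬ ¬ P i) → ¬ ¬ (∀ i → P i)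
¬¬-∀-Fin {zero}  _     k = k λ ()
¬¬-∀-Fin {suc n} ¬¬P k =
  ¬¬P zero λ P₀ → ¬¬-∀-Fin (¬¬P ∘ suc) λ Pₛ → k λ { zero → P₀ ; (suc i) → Pₛ i }

-- Instead of deciding connectivity, it is assumed decidable under a double negation;
-- this is harmless because the goal is a decidable inequality.
lemma3p6 : (k : ℕ) (G : Graph) → EdgeConnected G (suc k) →
    (F : Subset (nE G)) → IsFlat G F →
    (r rF : ℕ) → Rank G ⊤ r → Rank G F rF → rF + 2 ≡ r →
    2 * ∣ F ∣ + 3 * suc k ≤ 2 * nE G
lemma3p6 k G conn F _ r rF rk⊤ rkF@(_ , (RF , isRep⇔ , ∣RF∣≡cF) , _) rF+2≡r =
  decidable-stable (_ ≤? _) (¬¬-map bound (¬¬-∀-Fin λ u → ¬¬-∀-Fin λ v → ¬¬-excluded-middle))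
  where
  3≤∣RF∣ : 3 ≤ ∣ RF ∣
  3≤∣RF∣ = subst (3 ≤_) (sym ∣RF∣≡cF) (rank-drop<components rk⊤ rkF rF+2≡r)

  bound : Decidable (Connected G F) → 2 * ∣ F ∣ + 3 * suc k ≤ 2 * nE G
  bound _~?_ = ≤-trans (+-monoʳ-≤ (2 * ∣ F ∣) (*-monoˡ-≤ (suc k) 3≤∣RF∣))
    (components-bound _~?_ conn (≤-trans (s≤s (s≤s z≤n)) 3≤∣RF∣) (member RF)
      (representatives-separated (λ v → Equivalence.to (isRep⇔ v))))
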